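{- Suppose that the following statement holds: for every integer $n \ge 1$ and every subset $A = \{a_1,\dots,a_k\} \subseteq \mathbb{Z}_n \setminus \{0\}$ with $\sum_{a \in A} a \neq 0$ in $\mathbb{Z}_n$, there is an ordering of the elements of $A$ whose partial sums are all distinct and nonzero. Then for every integer $n\ge 1$ and every nonempty subset $A \subseteq \mathbb{Z}_n \setminus \{0\}$, there is an ordering of the elements of $A$ whose partial sums are all distinct.
   Context: For an ordering $(a_1,\dots,a_k)$ of a $k$-subset $A$ of $\mathbb{Z}_n$, the partial sums are $s_j = \sum_{i=1}^{j} a_i$ (computed in $\mathbb{Z}_n$) for $1 \le j \le k$. "The partial sums are all distinct" means $s_i \neq s_j$ whenever $1 \le i < j \le k$. -}

module Defs where

open import Data.Nat using (ℕ; zero; suc)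
open import Data.Nat.DivMod using (_mod_)
open import Data.Fin using (Fin; toℕ)
import Data.Nat as ℕ
open import Data.Fin.Subset using (Subset; _∈_; _∉_; Nonempty)
open import Data.Fin.Subset.Properties using (_∈?_)
open import Data.List using (List; []; _∷_; foldr; filter; allFin)
import Data.List.Membership.Propositional as LM
open import Data.List.Relation.Unary.Unique.Propositional using (Unique)
open import Data.List.Relation.Unary.All using (All)
open import Relation.Binary.PropositionalEquality using (_≢_)
open import Data.Product using (_×_; Σ)
open import Function.Bundles using (_⇔_)

-- ℤ_n with n = suc m (so n ≥ 1), elements represented by Fin (suc m).
-- Addition modulo n.
_⊕_ : ∀ {m} → Fin (suc m) → Fin (suc m) → Fin (suc m)
_⊕_ {m} a b = (toℕ a ℕ.+ toℕ b) mod (suc m)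

infixl 6 _⊕_

0ₙ : ∀ {m} → Fin (suc m)
0ₙ = Data.Fin.zero

sumL : ∀ {m} → List (Fin (suc m)) → Fin (suc m)
sumL = foldr _⊕_ 0ₙ

sumSubset : ∀ {m} → Subset (suc m) → Fin (suc m)
sumSubset {m} A = sumL (filter (_∈? A) (allFin (suc m)))

partialSumsFrom : ∀ {m} → Fin (suc m) → List (Fin (suc m)) → List (Fin (suc m))
partialSumsFrom s [] = []
partialSumsFrom s (a ∷ as) = (s ⊕ a) ∷ partialSumsFrom (s ⊕ a) as

partialSums : ∀ {m} → List (Fin (suc m)) → List (Fin (suc m))
partialSums = partialSumsFrom 0ₙ

IsOrdering : ∀ {n} → List (Fin n) → Subset n → Set
IsOrdering l A = Unique l × (∀ x → (x LM.∈ l) ⇔ (x ∈ A))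

AvoidsZero : ∀ {m} → Subset (suc m) → Set
AvoidsZero A = 0ₙ ∉ A

Hypothesis : Set
Hypothesis = ∀ (m : ℕ) (A : Subset (suc m)) → AvoidsZero A → sumSubset A ≢ 0ₙ →
  Σ (List (Fin (suc m))) λ l → IsOrdering l A × Unique (partialSums l) × All (_≢ 0ₙ) (partialSums l)

Conclusion : Set
Conclusion = ∀ (m : ℕ) (A : Subset (suc m)) → AvoidsZero A → Nonempty A →
  Σ (List (Fin (suc m))) λ l → IsOrdering l A × Unique (partialSums l)

-- If Σ A ≠ 0 the hypothesis applies to A itself. Otherwise pick any a ∈ A: since a ≠ 0,
-- A ∖ {a} has sum −a ≠ 0, so it has an ordering whose partial sums are distinct and
-- nonzero; appending a adds the final partial sum Σ A = 0, which is therefore new.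
module Submission where

open import Defs
open import Algebra.Structures using (IsCommutativeMonoid)
open import Algebra.Structures.Biased using (isCommutativeMonoidˡ)
open import Data.Fin using (Fin; toℕ; _≟_)
open import Data.Fin.Properties using (toℕ-fromℕ<; toℕ-injective; toℕ<n)
open import Data.Fin.Subset using (Subset; _∈_; _∉_; _─_; _-_; ⁅_⁆)
open import Data.Fin.Subset.Properties using (_∈?_; p─q⊆p; x∈p∧x≢y⇒x∈p-y; x∈⁅x⁆)
open import Data.List using (List; []; _∷_; [_]; _++_; filter; allFin)
import Data.List.Membership.Propositional as List
open import Data.List.Membership.Propositional.Properties using (∈-filter⁺; ∈-filter⁻; ∈-allFin; ∈-++⁺ˡ; ∈-++⁺ʳ; ∈-++⁻)
open import Data.List.Membership.Propositional.Properties.WithK using (unique∧set⇒bag)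
open import Data.List.Relation.Binary.BagAndSetEquality using (∼bag⇒↭)
open import Data.List.Relation.Binary.Permutation.Propositional using (_↭_; ↭⇒↭ₛ)
open import Data.List.Relation.Binary.Permutation.Setoid.Properties using (foldr-commMonoid)
open import Data.List.Relation.Unary.All as All using (All; [])
open import Data.List.Relation.Unary.AllPairs using ([]; _∷_)
open import Data.List.Relation.Unary.Any using (here)
open import Data.List.Relation.Unary.Unique.Propositional using (Unique)
import Data.List.Relation.Unary.Unique.Propositional.Properties as Unique
open import Data.Nat using (ℕ; suc; _+_; _%_; NonZero)
open import Data.Nat.DivMod using (_mod_; %-distribˡ-+; m%n%n≡m%n; m<n⇒m%n≡m)
open import Data.Nat.Properties using (+-comm; +-assoc)
open import Data.Product using (_,_; proj₂)
open import Data.Sum using (inj₁; inj₂)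
open import Data.Vec using (_∷_; here; there)
open import Function.Base using (_∘_)
open import Function.Bundles using (mk⇔; Equivalence)
import Function.Properties.Equivalence as ⇔
open import Relation.Binary.PropositionalEquality using (_≡_; _≢_; refl; sym; trans; cong; subst; setoid; module ≡-Reasoning)
open import Relation.Binary.PropositionalEquality.Algebra using (isMagma)
open import Relation.Nullary using (yes; no)

[m%d+n]%d≡[m+n]%d : ∀ m n d .{{_ : NonZero d}} → (m % d + n) % d ≡ (m + n) % d
[m%d+n]%d≡[m+n]%d m n d = begin
  (m % d + n) % d           ≡⟨ %-distribˡ-+ (m % d) n d ⟩
  (m % d % d + n % d) % d   ≡⟨ cong (λ k → (k + n % d) % d) (m%n%n≡m%n m d) ⟩
  (m % d + n % d) % d       ≡⟨ %-distribˡ-+ m n d ⟨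
  (m + n) % d               ∎
  where open ≡-Reasoning

module _ {m : ℕ} where

  toℕ-⊕ : (a b : Fin (suc m)) → toℕ (a ⊕ b) ≡ (toℕ a + toℕ b) % suc m
  toℕ-⊕ a b = toℕ-fromℕ< _

  %≡%⇒mod≡mod : ∀ {x y} → x % suc m ≡ y % suc m → x mod suc m ≡ y mod suc m
  %≡%⇒mod≡mod eq = toℕ-injective (trans (toℕ-fromℕ< _) (trans eq (sym (toℕ-fromℕ< _))))

  ⊕-comm : (a b : Fin (suc m)) → a ⊕ b ≡ b ⊕ a
  ⊕-comm a b = cong (_mod suc m) (+-comm (toℕ a) (toℕ b))

  ⊕-assoc : (a b c : Fin (suc m)) → (a ⊕ b) ⊕ c ≡ a ⊕ (b ⊕ c)
  ⊕-assoc a b c = %≡%⇒mod≡mod {toℕ (a ⊕ b) + toℕ c} {toℕ a + toℕ (b ⊕ c)} (begin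
    (toℕ (a ⊕ b) + z) % n      ≡⟨ cong (λ k → (k + z) % n) (toℕ-⊕ a b) ⟩
    ((x + y) % n + z) % n      ≡⟨ [m%d+n]%d≡[m+n]%d (x + y) z n ⟩
    (x + y + z) % n            ≡⟨ cong (_% n) (trans (+-assoc x y z) (+-comm x (y + z))) ⟩
    (y + z + x) % n            ≡⟨ [m%d+n]%d≡[m+n]%d (y + z) x n ⟨
    ((y + z) % n + x) % n      ≡⟨ cong (_% n) (+-comm ((y + z) % n) x) ⟩
    (x + (y + z) % n) % n      ≡⟨ cong (λ k → (x + k) % n) (toℕ-⊕ b c) ⟨
    (x + toℕ (b ⊕ c)) % n      ∎)
    where
    open ≡-Reasoning
    n x y z : ℕ
    n = suc m
    x = toℕ a
    y = toℕ b
    z = toℕ c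

  ⊕-identityˡ : (a : Fin (suc m)) → 0ₙ ⊕ a ≡ a
  ⊕-identityˡ a = toℕ-injective (trans (toℕ-fromℕ< _) (m<n⇒m%n≡m (toℕ<n a)))

  ⊕-identityʳ : (a : Fin (suc m)) → a ⊕ 0ₙ ≡ a
  ⊕-identityʳ a = trans (⊕-comm a 0ₙ) (⊕-identityˡ a)

  ⊕-isCommutativeMonoid : IsCommutativeMonoid _≡_ _⊕_ 0ₙ
  ⊕-isCommutativeMonoid = isCommutativeMonoidˡ record
    { isSemigroup = record { isMagma = isMagma _⊕_ ; assoc = ⊕-assoc }
    ; identityˡ   = ⊕-identityˡ
    ; comm        = ⊕-comm
    }

  sumL-↭ : {xs ys : List (Fin (suc m))} → xs ↭ ys → sumL xs ≡ sumL ys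
  sumL-↭ p = foldr-commMonoid (setoid _) ⊕-isCommutativeMonoid (↭⇒↭ₛ p)

  sumL-++-[] : (l : List (Fin (suc m))) (a : Fin (suc m)) → sumL (l ++ [ a ]) ≡ sumL l ⊕ a
  sumL-++-[] []      a = trans (⊕-identityʳ a) (sym (⊕-identityˡ a))
  sumL-++-[] (x ∷ l) a = trans (cong (x ⊕_) (sumL-++-[] l a)) (sym (⊕-assoc x (sumL l) a))

  partialSumsFrom-++-[] : (s : Fin (suc m)) (l : List (Fin (suc m))) (a : Fin (suc m)) →
                          partialSumsFrom s (l ++ [ a ]) ≡ partialSumsFrom s l ++ [ s ⊕ sumL (l ++ [ a ]) ]
  partialSumsFrom-++-[] s []      a = cong (λ t → [ s ⊕ t ]) (sym (⊕-identityʳ a))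
  partialSumsFrom-++-[] s (x ∷ l) a = cong ((s ⊕ x) ∷_) (begin
    partialSumsFrom (s ⊕ x) (l ++ [ a ])                            ≡⟨ partialSumsFrom-++-[] (s ⊕ x) l a ⟩
    partialSumsFrom (s ⊕ x) l ++ [ (s ⊕ x) ⊕ sumL (l ++ [ a ]) ]    ≡⟨ cong (λ t → partialSumsFrom (s ⊕ x) l ++ [ t ]) (⊕-assoc s x _) ⟩
    partialSumsFrom (s ⊕ x) l ++ [ s ⊕ sumL (x ∷ l ++ [ a ]) ]      ∎)
    where open ≡-Reasoning

-- The missing 'here' case is impossible: p ─ q is outside wherever q is inside.
x∈p─q⇒x∉q : ∀ {n} (p q : Subset n) {x : Fin n} → x ∈ p ─ q → x ∉ q
x∈p─q⇒x∉q (_ ∷ p) (_ ∷ q) (there x∈p─q) (there x∈q) = x∈p─q⇒x∉q p q x∈p─q x∈q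

unique-++-[] : ∀ {a} {A : Set a} {xs : List A} {y} → Unique xs → y List.∉ xs → Unique (xs ++ [ y ])
unique-++-[] xs! y∉xs = Unique.++⁺ xs! ([] ∷ []) λ where (y∈xs , here refl) → y∉xs y∈xs

module _ {n : ℕ} where

  isOrdering-filter : (A : Subset n) → IsOrdering (filter (_∈? A) (allFin n)) A
  isOrdering-filter A =
    Unique.filter⁺ (_∈? A) (Unique.allFin⁺ n) ,
    λ x → mk⇔ (λ x∈l → proj₂ (∈-filter⁻ (_∈? A) {xs = allFin n} x∈l))
              (∈-filter⁺ (_∈? A) (∈-allFin x))

  isOrdering-↭ : ∀ {A} {xs ys : List (Fin n)} → IsOrdering xs A → IsOrdering ys A → xs ↭ ys
  isOrdering-↭ (xs! , xs≈A) (ys! , ys≈A) =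
    ∼bag⇒↭ (unique∧set⇒bag xs! ys! (λ {x} → ⇔.trans (xs≈A x) (⇔.sym (ys≈A x))))

  isOrdering-++-[] : ∀ {A a} {l : List (Fin n)} → a ∈ A → IsOrdering l (A - a) → IsOrdering (l ++ [ a ]) A
  isOrdering-++-[] {A} {a} {l} a∈A (l! , l≈A-a) =
    unique-++-[] l! a∉l , λ x → mk⇔ (to x) (from x)
    where
    a∉l : a List.∉ l
    a∉l a∈l = x∈p─q⇒x∉q A ⁅ a ⁆ (Equivalence.to (l≈A-a a) a∈l) (x∈⁅x⁆ a)
    to : ∀ x → x List.∈ l ++ [ a ] → x ∈ A
    to x x∈ with ∈-++⁻ l x∈
    ... | inj₁ x∈l        = p─q⊆p A ⁅ a ⁆ (Equivalence.to (l≈A-a x) x∈l)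
    ... | inj₂ (here refl) = a∈A
    from : ∀ x → x ∈ A → x List.∈ l ++ [ a ]
    from x x∈A with x ≟ a
    ... | yes refl = ∈-++⁺ʳ l (here refl)
    ... | no x≢a   = ∈-++⁺ˡ (Equivalence.from (l≈A-a x) (x∈p∧x≢y⇒x∈p-y x∈A x≢a))

module _ {m : ℕ} where

  sumL-isOrdering : ∀ {A} {l : List (Fin (suc m))} → IsOrdering l A → sumL l ≡ sumSubset A
  sumL-isOrdering {A} l-ord = sumL-↭ (isOrdering-↭ l-ord (isOrdering-filter A))

  sumSubset-remove : ∀ {A a} → a ∈ A → sumSubset A ≡ sumSubset (A - a) ⊕ a
  sumSubset-remove {A} {a} a∈A = begin
    sumSubset A              ≡⟨ sumL-isOrdering (isOrdering-++-[] a∈A (isOrdering-filter (A - a))) ⟨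
    sumL (l ++ [ a ])        ≡⟨ sumL-++-[] l a ⟩
    sumSubset (A - a) ⊕ a    ∎
    where
    open ≡-Reasoning
    l : List (Fin (suc m))
    l = filter (_∈? A - a) (allFin (suc m))

  partialSums-isOrdering-++-[] : ∀ {A a} {l : List (Fin (suc m))} → IsOrdering (l ++ [ a ]) A →
                                 partialSums (l ++ [ a ]) ≡ partialSums l ++ [ sumSubset A ]
  partialSums-isOrdering-++-[] {a = a} {l} l-ord = trans (partialSumsFrom-++-[] 0ₙ l a)
    (cong (λ t → partialSums l ++ [ t ]) (trans (⊕-identityˡ _) (sumL-isOrdering l-ord)))

  sumSubset≡0⇒sumSubset[-]≢0 : ∀ {A a} → 0ₙ ∉ A → a ∈ A → sumSubset A ≡ 0ₙ → sumSubset (A - a) ≢ 0ₙ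
  sumSubset≡0⇒sumSubset[-]≢0 {A} {a} 0∉A a∈A ΣA≡0 ΣA-a≡0 = 0∉A (subst (_∈ A) a≡0 a∈A)
    where
    open ≡-Reasoning
    a≡0 : a ≡ 0ₙ
    a≡0 = begin
      a                       ≡⟨ ⊕-identityˡ a ⟨
      0ₙ ⊕ a                  ≡⟨ cong (_⊕ a) ΣA-a≡0 ⟨
      sumSubset (A - a) ⊕ a   ≡⟨ sumSubset-remove a∈A ⟨
      sumSubset A             ≡⟨ ΣA≡0 ⟩
      0ₙ                      ∎

proposition1 : Hypothesis → Conclusion
proposition1 H m A 0∉A (a , a∈A) with sumSubset A ≟ 0ₙ
... | no ΣA≢0 = let (l , l-ord , ps! , _) = H m A 0∉A ΣA≢0 in l , l-ord , ps!
... | yes ΣA≡0 with H m (A - a) (0∉A ∘ p─q⊆p A ⁅ a ⁆) (sumSubset≡0⇒sumSubset[-]≢0 0∉A a∈A ΣA≡0)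
...   | l , l-ord , ps! , ps≢0 = l ++ [ a ] , l+a-ord ,
        subst Unique (sym (partialSums-isOrdering-++-[] l+a-ord))
          (unique-++-[] ps! (λ ΣA∈ps → All.lookup ps≢0 ΣA∈ps ΣA≡0))
  where
  l+a-ord : IsOrdering (l ++ [ a ]) A
  l+a-ord = isOrdering-++-[] a∈A l-ord
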